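{- Let $r\ge 4$ and $n\in\mathbb{N}$ with $(r-2)\mid n$. Let $V\subseteq V(K_{r,2,n})$ with $r\le v:=|V|\le n/(2r)+1$. Then the number of edges of $K_{r,2,n}$ induced by $V$ is at most the number of edges induced by some segment of length $v$ (equivalently, at most the maximum over segments of length $v$).
   Context: For $r\ge 3$ and $(r-2)\mid n$, $K_{r,2,n}$ is the graph on $\mathbb{Z}_n=\{0,\dots,n-1\}$ whose edge set is the union of the edge sets of the $n/(r-2)$ cliques $K_r$ on the vertex sets $\{i(r-2),\dots,i(r-2)+r-1\}$ (mod $n$), $i\in\{0,\dots,n/(r-2)-1\}$. A segment is a set of consecutive vertices of $\mathbb{Z}_n$ (cyclically); its length is its number of vertices. -}

module Defs where

open import Data.Nat using (ℕ; zero; suc; _+_; _*_; _∸_; _≡ᵇ_; NonZero)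
open import Data.Nat.DivMod using (_%_)
open import Data.Bool using (Bool; true; false; _∧_; not; if_then_else_)
open import Data.List using (List; []; _∷_; map; upTo)
open import Data.Bool.ListAction using (any)

-- The graph K_{r,2,n} on vertex set Z_n = {0,…,n-1}, with q = n/(r-2) cliques:
-- clique i (i < q) has vertex set {(i(r-2)+j) mod n | j < r}.
inClique : (r n : ℕ) → .{{NonZero n}} → ℕ → ℕ → Bool
inClique r n i a = any (λ j → a ≡ᵇ ((i * (r ∸ 2) + j) % n)) (upTo r)

adj : (r q n : ℕ) → .{{NonZero n}} → ℕ → ℕ → Bool
adj r q n a b = not (a ≡ᵇ b) ∧ any (λ i → inClique r n i a ∧ inClique r n i b) (upTo q)

countTrue : {A : Set} → (A → Bool) → List A → ℕ
countTrue p [] = 0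
countTrue p (x ∷ xs) = (if p x then 1 else 0) + countTrue p xs

-- number of edges of K_{r,2,n} induced by the vertex list V
-- (each unordered pair of list positions is counted once; V is assumed duplicate-free)
inducedEdges : (r q n : ℕ) → .{{NonZero n}} → List ℕ → ℕ
inducedEdges r q n [] = 0
inducedEdges r q n (x ∷ xs) = countTrue (adj r q n x) xs + inducedEdges r q n xs

segment : (n : ℕ) → .{{NonZero n}} → ℕ → ℕ → List ℕ
segment n s v = map (λ j → (s + j) % n) (upTo v)

module Submission where

-- Cut ℤ_n into q blocks of d = r - 2 consecutive vertices: clique i is block i together with
-- the head of block i + 1, i.e. its first two vertices.  The bound on |V| forces |V| < q, so some
-- block of V has an absent predecessor block; each of its w ≤ d vertices then has at most
-- min(2, |V| - w) neighbours in V outside it (in the head of the next block).  Removing the block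
-- and inducting bounds e(V) by Σ_{p<|V|} backDegree p, the edge count of the segment
-- {0, …, |V| - 1}; the inductive step holds because w ≤ d consecutive residues mod d sum to at
-- least 0 + 1 + … + (w - 1).

open import Defs
open import Data.Bool using (Bool; true; false; T; if_then_else_; not; _∧_)
open import Data.Bool.ListAction using (or)
open import Data.Bool.Properties using (∧-comm; T-∧)
open import Data.Fin using (zero; suc)
open import Data.Fin.Properties using (pigeonhole) renaming (<⇒≢ to <⇒≢ᶠ)
open import Data.List using (List; []; _∷_; _++_; [_]; length; filter; applyUpTo; upTo; lookup; map)
open import Data.List.Membership.Propositional using (_∈_)
open import Data.List.Membership.Propositional.Properties
  using (∈-lookup; ∈-applyUpTo⁺; ∈-applyUpTo⁻; ∈-upTo⁺; ∈-upTo⁻; ∈-map⁺; ∈-map⁻; ∈-filter⁺; ∈-filter⁻)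
open import Data.List.Properties
  using (length-applyUpTo; length-map; length-upTo; upTo-∷ʳ; map-cong; map-id-local; filter-some)
open import Data.List.Relation.Binary.Subset.Propositional using (_⊆_)
open import Data.List.Relation.Unary.All as All using (All; []; _∷_)
open import Data.List.Relation.Unary.All.Properties as All using (all-filter)
open import Data.List.Relation.Unary.AllPairs using (_∷_)
open import Data.List.Relation.Unary.Any as Any using (index; here)
open import Data.List.Relation.Unary.Any.Properties using (lookup-index; any⁺; any⁻; applyUpTo⁺; applyUpTo⁻)
open import Data.List.Relation.Unary.Unique.Propositional using (Unique)
import Data.List.Relation.Unary.Unique.Propositional.Properties as Unique
open import Data.Nat
  using (ℕ; zero; suc; _+_; _*_; _∸_; _≤_; _<_; _⊓_; _≡ᵇ_; pred; z≤n; s≤s; _≤?_; _<?_; NonZero; >-nonZero⁻¹)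
open import Data.Nat.Divisibility using (n∣m*n)
open import Data.Nat.DivMod
open import Data.Nat.Induction using (<-wellFounded)
open import Data.Nat.Properties
open import Data.Nat.Properties using () renaming (_≟_ to _≟ℕ_)
open import Data.List.Membership.DecPropositional _≟ℕ_ using (_∈?_)
open import Algebra.Properties.CommutativeSemigroup +-commutativeSemigroup
  using (x∙yz≈y∙xz; xy∙z≈y∙xz; x∙yz≈z∙xy; interchange)
open import Data.Nat.Tactic.RingSolver using (solve-∀)
open import Data.Product using (Σ; _×_; _,_; ∃; proj₁; proj₂)
open import Data.Sum using (_⊎_; inj₁; inj₂)
open import Data.Unit using (tt)
open import Function using (_∘_; id)
open import Function.Bundles using (Equivalence)
open import Induction.WellFounded using (Acc; acc)
open import Relation.Binary.PropositionalEquality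
  using (_≡_; _≢_; refl; sym; trans; cong; cong₂; subst; subst₂; module ≡-Reasoning)
open import Relation.Nullary using (yes; no; contradiction)
open import Relation.Nullary.Decidable using (T?; ¬?; _×-dec_)
open import Relation.Unary using (Decidable)

module _ {A : Set} where

  countTrue≤length : (p : A → Bool) (xs : List A) → countTrue p xs ≤ length xs
  countTrue≤length p [] = z≤n
  countTrue≤length p (x ∷ xs) with p x
  ... | true  = s≤s (countTrue≤length p xs)
  ... | false = m≤n⇒m≤1+n (countTrue≤length p xs)

  countTrue≡length-filter : (p : A → Bool) (xs : List A) →
                            countTrue p xs ≡ length (filter (T? ∘ p) xs)
  countTrue≡length-filter p [] = refl
  countTrue≡length-filter p (x ∷ xs) with p x
  ... | true  = cong suc (countTrue≡length-filter p xs)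
  ... | false = countTrue≡length-filter p xs

  countTrue-++ : (p : A → Bool) (xs ys : List A) →
                 countTrue p (xs ++ ys) ≡ countTrue p xs + countTrue p ys
  countTrue-++ p []       ys = refl
  countTrue-++ p (x ∷ xs) ys =
    trans (cong ((if p x then 1 else 0) +_) (countTrue-++ p xs ys)) (sym (+-assoc (if p x then 1 else 0) _ _))

  module _ {P : A → Set} (P? : Decidable P) where

    length-filter-∁ : (xs : List A) →
                      length (filter P? xs) + length (filter (¬? ∘ P?) xs) ≡ length xs
    length-filter-∁ [] = refl
    length-filter-∁ (x ∷ xs) with P? x
    ... | yes _ = cong suc (length-filter-∁ xs)
    ... | no  _ = trans (+-suc _ _) (cong suc (length-filter-∁ xs))

    countTrue-filter-∁ : (f : A → Bool) (xs : List A) →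
                         countTrue f xs ≡ countTrue f (filter P? xs) + countTrue f (filter (¬? ∘ P?) xs)
    countTrue-filter-∁ f [] = refl
    countTrue-filter-∁ f (x ∷ xs) with ih ← countTrue-filter-∁ f xs | P? x
    ... | yes _ = trans (cong (fx +_) ih) (sym (+-assoc fx _ _))
      where fx = if f x then 1 else 0
    ... | no  _ = trans (cong (fx +_) ih) (x∙yz≈y∙xz fx (countTrue f (filter P? xs)) _)
      where fx = if f x then 1 else 0

lookup-injective : {A : Set} {xs : List A} → Unique xs → ∀ i j → lookup xs i ≡ lookup xs j → i ≡ j
lookup-injective (_   ∷ _) zero    zero    _  = refl
lookup-injective (x≢ ∷ _) zero    (suc j) eq = contradiction eq (All.lookup x≢ (∈-lookup j))
lookup-injective (x≢ ∷ _) (suc i) zero    eq = contradiction (sym eq) (All.lookup x≢ (∈-lookup i))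
lookup-injective (_   ∷ u) (suc i) (suc j) eq = cong suc (lookup-injective u i j eq)

Unique-⊆⇒length≤ : {A : Set} {xs ys : List A} → Unique xs → xs ⊆ ys → length xs ≤ length ys
Unique-⊆⇒length≤ {xs = xs} {ys} u xs⊆ys with length xs ≤? length ys
... | yes le = le
... | no  gt with i , j , i<j , eq ← pigeonhole (≰⇒> gt) (index ∘ xs⊆ys ∘ ∈-lookup)
  = contradiction (lookup-injective u i j (trans (lookup-index (xs⊆ys (∈-lookup i)))
                     (trans (cong (lookup ys) eq) (sym (lookup-index (xs⊆ys (∈-lookup j)))))))
                  (<⇒≢ᶠ i<j)

Unique⇒length≤width : ∀ a m {xs : List ℕ} → Unique xs → All (λ x → a ≤ x × x < a + m) xs →
                      length xs ≤ m
Unique⇒length≤width a m {xs} u inRange = begin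
  length xs                    ≤⟨ Unique-⊆⇒length≤ u xs⊆range ⟩
  length (applyUpTo (a +_) m)  ≡⟨ length-applyUpTo (a +_) m ⟩
  m                            ∎
  where
  open ≤-Reasoning
  xs⊆range : xs ⊆ applyUpTo (a +_) m
  xs⊆range {x} x∈xs with a≤x , x<a+m ← All.lookup inRange x∈xs =
    subst (_∈ applyUpTo (a +_) m) (m+[n∸m]≡n a≤x)
      (∈-applyUpTo⁺ (a +_) (+-cancelˡ-< a _ _ (subst (_< a + m) (sym (m+[n∸m]≡n a≤x)) x<a+m)))

countTrue-upTo-≥ : (f : ℕ → Bool) → ∀ lo m → (∀ i → i < m → T (f (lo + i))) →
                   m ≤ countTrue f (upTo (lo + m))
countTrue-upTo-≥ f lo m holds = begin
  m                                         ≡⟨ length-applyUpTo (lo +_) m ⟨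
  length (applyUpTo (lo +_) m)              ≤⟨ Unique-⊆⇒length≤ unique ⊆filter ⟩
  length (filter (T? ∘ f) (upTo (lo + m)))  ≡⟨ countTrue≡length-filter f (upTo (lo + m)) ⟨
  countTrue f (upTo (lo + m))               ∎
  where
  open ≤-Reasoning
  unique : Unique (applyUpTo (lo +_) m)
  unique = Unique.applyUpTo⁺₁ (lo +_) m (λ i<j _ → <⇒≢ (+-monoʳ-< lo i<j))
  ⊆filter : applyUpTo (lo +_) m ⊆ filter (T? ∘ f) (upTo (lo + m))
  ⊆filter y∈ with i , i<m , refl ← ∈-applyUpTo⁻ (lo +_) y∈ =
    ∈-filter⁺ (T? ∘ f) (∈-upTo⁺ (+-monoʳ-< lo i<m)) (holds i i<m)

downward-closed : {P : ℕ → Set} → (∀ i → P (suc i) → P i) → ∀ {m j} → j ≤ m → P m → P j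
downward-closed step {zero}  z≤n  P0 = P0
downward-closed step {suc m} j≤1+m P1+m with m≤n⇒m<n∨m≡n j≤1+m
... | inj₁ j<1+m = downward-closed step (≤-pred j<1+m) (step m P1+m)
... | inj₂ refl  = P1+m

few-vertices : ∀ d q v → 2 ≤ v → 2 * (2 + d) * (v ∸ 1) ≤ q * d → v < q
few-vertices d q zero          ()              _
few-vertices d q (suc zero)    (s≤s ())        _
few-vertices d q v@(suc (suc u)) _ bound with v <? q
... | yes v<q = v<q
... | no  v≮q = contradiction (begin-strict
    q * d                   ≤⟨ *-monoˡ-≤ d (≮⇒≥ v≮q) ⟩
    v * d                   <⟨ s≤s (m≤m+n (v * d) _) ⟩
    suc (v * d + (3 + 4 * u + u * d)) ≡⟨ expand d u ⟨
    2 * (2 + d) * suc u     ≤⟨ bound ⟩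
    q * d                   ∎) (<-irrefl refl)
  where
  open ≤-Reasoning
  expand : ∀ d u → 2 * (2 + d) * suc u ≡ suc (suc (suc u) * d + (3 + 4 * u + u * d))
  expand = solve-∀

∑< : ℕ → (ℕ → ℕ) → ℕ
∑< zero    f = 0
∑< (suc w) f = ∑< w f + f w

syntax ∑< w (λ t → e) = ∑[ t < w ] e

∑-mono-≤ : ∀ w {f g : ℕ → ℕ} → (∀ t → t < w → f t ≤ g t) → ∑< w f ≤ ∑< w g
∑-mono-≤ zero    f≤g = z≤n
∑-mono-≤ (suc w) f≤g =
  +-mono-≤ (∑-mono-≤ w (λ t t<w → f≤g t (m≤n⇒m≤1+n t<w))) (f≤g w ≤-refl)

∑-+ : ∀ k m (f : ℕ → ℕ) → ∑< (k + m) f ≡ ∑< k f + ∑[ t < m ] f (k + t)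
∑-+ k zero    f = trans (cong (λ w → ∑< w f) (+-identityʳ k)) (sym (+-identityʳ _))
∑-+ k (suc m) f = begin
  ∑< (k + suc m) f                                ≡⟨ cong (λ w → ∑< w f) (+-suc k m) ⟩
  ∑< (k + m) f + f (k + m)                        ≡⟨ cong (_+ f (k + m)) (∑-+ k m f) ⟩
  ∑< k f + ∑[ t < m ] f (k + t) + f (k + m)       ≡⟨ +-assoc (∑< k f) _ _ ⟩
  ∑< k f + ∑[ t < suc m ] f (k + t)               ∎
  where open ≡-Reasoning

∑-const+ : ∀ w c (f : ℕ → ℕ) → ∑[ t < w ] (c + f t) ≡ w * c + ∑< w f
∑-const+ zero    c f = refl
∑-const+ (suc w) c f = begin
  ∑[ t < w ] (c + f t) + (c + f w)  ≡⟨ cong (_+ (c + f w)) (∑-const+ w c f) ⟩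
  w * c + ∑< w f + (c + f w)        ≡⟨ interchange (w * c) (∑< w f) c (f w) ⟩
  w * c + c + (∑< w f + f w)        ≡⟨ cong (_+ (∑< w f + f w)) (+-comm (w * c) c) ⟩
  suc w * c + ∑< (suc w) f          ∎
  where open ≡-Reasoning

module _ (d : ℕ) .{{_ : NonZero d}} where

  ∑id≤∑residues : ∀ s w → w ≤ d → ∑[ t < w ] t ≤ ∑[ t < w ] ((s + t) % d)
  ∑id≤∑residues s w w≤d = begin
    ∑[ t < w ] t                  ≤⟨ window (m%n<n s d) ⟩
    ∑[ t < w ] ((s % d + t) % d)  ≤⟨ ∑-mono-≤ w (λ t t<w → ≤-reflexive (reduce t (<-≤-trans t<w w≤d))) ⟩
    ∑[ t < w ] ((s + t) % d)      ∎
    where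
    open ≤-Reasoning
    reduce : ∀ t → t < d → ((s % d + t) % d) ≡ ((s + t) % d)
    reduce t t<d = sym (trans (%-distribˡ-+ s t d) (cong (λ u → (s % d + u) % d) (m<n⇒m%n≡m t<d)))

    window : ∀ {a} → a < d → ∑[ t < w ] t ≤ ∑[ t < w ] ((a + t) % d)
    window {a} a<d with a + w ≤? d
    ... | yes a+w≤d = ∑-mono-≤ w λ t t<w →
          subst (t ≤_) (sym (m<n⇒m%n≡m (<-≤-trans (+-monoʳ-< a t<w) a+w≤d))) (m≤n+m t a)
    ... | no  a+w≰d = begin
      ∑[ t < w ] t                                ≡⟨ cong (λ u → ∑[ t < u ] t) w≡m+k ⟩
      ∑[ t < m + k ] t                            ≡⟨ ∑-+ m k (λ t → t) ⟩
      ∑[ t < m ] t + ∑[ t < k ] (m + t)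
        ≤⟨ +-mono-≤ (∑-mono-≤ m wrapped) (∑-mono-≤ k unwrapped) ⟩
      ∑[ t < m ] g (k + t) + ∑[ t < k ] g t       ≡⟨ +-comm _ (∑[ t < k ] g t) ⟩
      ∑[ t < k ] g t + ∑[ t < m ] g (k + t)       ≡⟨ ∑-+ k m g ⟨
      ∑[ t < k + m ] g t                          ≡⟨ cong (λ u → ∑[ t < u ] g t) (+-comm k m) ⟩
      ∑[ t < m + k ] g t                          ≡⟨ cong (λ u → ∑[ t < u ] g t) w≡m+k ⟨
      ∑[ t < w ] g t                              ∎
      where
      g : ℕ → ℕ
      g t = (a + t) % d
      k = d ∸ a
      m = w ∸ k
      a+k≡d : a + k ≡ d
      a+k≡d = m+[n∸m]≡n (<⇒≤ a<d)
      k≤w : k ≤ w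
      k≤w = +-cancelˡ-≤ a k w (subst (_≤ a + w) (sym a+k≡d) (<⇒≤ (≰⇒> a+w≰d)))
      w≡m+k : w ≡ m + k
      w≡m+k = sym (m∸n+n≡m k≤w)
      m≤a : m ≤ a
      m≤a = +-cancelʳ-≤ k m a (subst₂ _≤_ w≡m+k (sym a+k≡d) w≤d)
      wrapped : ∀ t → t < m → t ≤ g (k + t)
      wrapped t t<m = ≤-reflexive (sym (begin-equality
        (a + (k + t)) % d   ≡⟨ cong (_% d) (trans (sym (+-assoc a k t)) (cong (_+ t) a+k≡d)) ⟩
        (d + t) % d         ≡⟨ cong (_% d) (+-comm d t) ⟩
        (t + d) % d         ≡⟨ [m+n]%n≡m%n t d ⟩
        t % d               ≡⟨ m<n⇒m%n≡m (<-≤-trans t<m (≤-trans m≤a (<⇒≤ a<d))) ⟩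
        t                   ∎))
      unwrapped : ∀ t → t < k → m + t ≤ g t
      unwrapped t t<k = subst (m + t ≤_) (sym (m<n⇒m%n≡m (subst (a + t <_) a+k≡d (+-monoʳ-< a t<k))))
                          (+-monoˡ-≤ t m≤a)

  [m*d+t]/d≡m : ∀ m {t} → t < d → (m * d + t) / d ≡ m
  [m*d+t]/d≡m m {t} t<d = begin-equality
    (m * d + t) / d    ≡⟨ +-distrib-/-∣ˡ t (n∣m*n m) ⟩
    m * d / d + t / d  ≡⟨ cong₂ _+_ (m*n/n≡m m d) (m<n⇒m/n≡0 t<d) ⟩
    m + 0              ≡⟨ +-identityʳ m ⟩
    m                  ∎
    where open ≤-Reasoning

  [m*d+t]%d≡t : ∀ m {t} → t < d → (m * d + t) % d ≡ t
  [m*d+t]%d≡t m {t} t<d = trans (%-remove-+ˡ t (n∣m*n m)) (m<n⇒m%n≡m t<d)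

  /≡⇒bounds : ∀ x {c w} → x / d ≡ c → x % d < w → c * d ≤ x × x < c * d + w
  /≡⇒bounds x {c} {w} refl x%d<w =
    subst (λ y → c * d ≤ y × y < c * d + w) (sym x≡) (m≤m+n (c * d) _ , +-monoʳ-< (c * d) x%d<w)
    where
    x≡ : x ≡ c * d + x % d
    x≡ = trans (m≡m%n+[m/n]*n x d) (+-comm (x % d) (c * d))

  -- the number of neighbours of p among 0, …, p - 1 (for p < n)
  backDegree : ℕ → ℕ
  backDegree p = 2 ⊓ p + (p ∸ 2) % d

  segmentBound : ℕ → ℕ
  segmentBound v = ∑[ p < v ] backDegree p

  backDegree-small : ∀ p → p < 2 + d → backDegree p ≡ p
  backDegree-small p p<2+d =
    trans (cong (2 ⊓ p +_) (m<n⇒m%n≡m (∸2< p p<2+d))) (m⊓n+n∸m≡n 2 p)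
    where
    ∸2< : ∀ p → p < 2 + d → p ∸ 2 < d
    ∸2< zero          _               = >-nonZero⁻¹ d
    ∸2< (suc zero)    _               = >-nonZero⁻¹ d
    ∸2< (suc (suc p)) (s≤s (s≤s p<d)) = p<d

  segmentBound-+ : ∀ v w → w ≤ d →
                   segmentBound v + (∑[ t < w ] t + w * (2 ⊓ v)) ≤ segmentBound (v + w)
  segmentBound-+ v w w≤d = begin
    segmentBound v + (∑[ t < w ] t + w * (2 ⊓ v))  ≤⟨ +-monoʳ-≤ (segmentBound v) (appended v) ⟩
    segmentBound v + ∑[ t < w ] backDegree (v + t) ≡⟨ ∑-+ v w backDegree ⟨
    segmentBound (v + w)                           ∎
    where
    open ≤-Reasoning
    initial : ∀ v → v ≤ 1 → ∑[ t < w ] t + w * v ≤ ∑[ t < w ] backDegree (v + t)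
    initial v v≤1 = begin
      ∑[ t < w ] t + w * v         ≡⟨ +-comm _ (w * v) ⟩
      w * v + ∑[ t < w ] t         ≡⟨ ∑-const+ w v (λ t → t) ⟨
      ∑[ t < w ] (v + t)           ≤⟨ ∑-mono-≤ w (λ t t<w → ≤-reflexive (sym (backDegree-small (v + t)
                                        (s≤s (+-mono-≤ v≤1 (<⇒≤ (<-≤-trans t<w w≤d))))))) ⟩
      ∑[ t < w ] backDegree (v + t) ∎
    appended : ∀ v → ∑[ t < w ] t + w * (2 ⊓ v) ≤ ∑[ t < w ] backDegree (v + t)
    appended zero          = initial 0 z≤n
    appended (suc zero)    = initial 1 ≤-refl
    appended (suc (suc s)) = begin
      ∑[ t < w ] t + w * 2                ≡⟨ +-comm _ (w * 2) ⟩
      w * 2 + ∑[ t < w ] t                ≤⟨ +-monoʳ-≤ (w * 2) (∑id≤∑residues s w w≤d) ⟩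
      w * 2 + ∑[ t < w ] ((s + t) % d)      ≡⟨ ∑-const+ w 2 (λ t → (s + t) % d) ⟨
      ∑[ t < w ] (2 + (s + t) % d)        ∎

module InducedEdges {X : Set} (A : X → X → Bool) (A-sym : ∀ x y → A x y ≡ A y x) where

  edges : List X → ℕ
  edges []       = 0
  edges (x ∷ xs) = countTrue (A x) xs + edges xs

  cross : List X → List X → ℕ
  cross []       ys = 0
  cross (x ∷ xs) ys = countTrue (A x) ys + cross xs ys

  edges≤∑ : ∀ xs → edges xs ≤ ∑[ t < length xs ] t
  edges≤∑ []       = z≤n
  edges≤∑ (x ∷ xs) = subst (edges (x ∷ xs) ≤_) (+-comm (length xs) _)
                       (+-mono-≤ (countTrue≤length (A x) xs) (edges≤∑ xs))

  cross≤ : ∀ {k} xs ys → All (λ x → countTrue (A x) ys ≤ k) xs → cross xs ys ≤ length xs * k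
  cross≤ []       ys []           = z≤n
  cross≤ (x ∷ xs) ys (x≤k ∷ xs≤k) = +-mono-≤ x≤k (cross≤ xs ys xs≤k)

  edges-∷ʳ : ∀ xs y → edges (xs ++ [ y ]) ≡ edges xs + countTrue (λ x → A x y) xs
  edges-∷ʳ []       y = refl
  edges-∷ʳ (x ∷ xs) y = begin
    countTrue (A x) (xs ++ [ y ]) + edges (xs ++ [ y ])
      ≡⟨ cong₂ _+_ (trans (countTrue-++ (A x) xs [ y ]) (cong (countTrue (A x) xs +_) (+-identityʳ _)))
                   (edges-∷ʳ xs y) ⟩
    (countTrue (A x) xs + Axy) + (edges xs + countTrue (λ z → A z y) xs)
      ≡⟨ interchange (countTrue (A x) xs) Axy (edges xs) (countTrue (λ z → A z y) xs) ⟩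
    (countTrue (A x) xs + edges xs) + (Axy + countTrue (λ z → A z y) xs)
      ≡⟨⟩
    edges (x ∷ xs) + countTrue (λ z → A z y) (x ∷ xs) ∎
    where
    open ≡-Reasoning
    Axy = if A x y then 1 else 0

  cross-∷ : ∀ xs y ys → cross xs (y ∷ ys) ≡ countTrue (A y) xs + cross xs ys
  cross-∷ []       y ys = refl
  cross-∷ (x ∷ xs) y ys = begin
    (Axy + countTrue (A x) ys) + cross xs (y ∷ ys)
      ≡⟨ cong (Axy + countTrue (A x) ys +_) (cross-∷ xs y ys) ⟩
    (Axy + countTrue (A x) ys) + (countTrue (A y) xs + cross xs ys)
      ≡⟨ interchange Axy (countTrue (A x) ys) (countTrue (A y) xs) (cross xs ys) ⟩
    (Axy + countTrue (A y) xs) + (countTrue (A x) ys + cross xs ys)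
      ≡⟨ cong (λ b → ((if b then 1 else 0) + countTrue (A y) xs) + rest) (A-sym x y) ⟩
    countTrue (A y) (x ∷ xs) + cross (x ∷ xs) ys
      ∎
    where
    open ≡-Reasoning
    Axy = if A x y then 1 else 0
    rest = countTrue (A x) ys + cross xs ys

  module _ {P : X → Set} (P? : Decidable P) where

    edges-filter-∁ : ∀ xs → let ys = filter P? xs; zs = filter (¬? ∘ P?) xs in
                     edges xs ≡ edges ys + edges zs + cross ys zs
    edges-filter-∁ []       = refl
    edges-filter-∁ (x ∷ xs) with ih ← edges-filter-∁ xs | P? x
    ... | yes _ = trans (cong₂ _+_ (countTrue-filter-∁ P? (A x) xs) ih)
                        (into-ys (countTrue (A x) ys) (countTrue (A x) zs) (edges ys) (edges zs) (cross ys zs))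
      where
      ys = filter P? xs
      zs = filter (¬? ∘ P?) xs
      into-ys : ∀ a b c d e → (a + b) + ((c + d) + e) ≡ ((a + c) + d) + (b + e)
      into-ys = solve-∀
    ... | no  _ = trans (cong₂ _+_ (countTrue-filter-∁ P? (A x) xs) ih)
                        (trans (into-zs (countTrue (A x) ys) (countTrue (A x) zs) (edges ys) (edges zs) (cross ys zs))
                               (cong (edges ys + (countTrue (A x) zs + edges zs) +_) (sym (cross-∷ ys x zs))))
      where
      ys = filter P? xs
      zs = filter (¬? ∘ P?) xs
      into-zs : ∀ a b c d e → (a + b) + ((c + d) + e) ≡ (c + (b + d)) + (a + e)
      into-zs = solve-∀

≡ᵇ-comm : ∀ m n → (m ≡ᵇ n) ≡ (n ≡ᵇ m)
≡ᵇ-comm zero    zero    = refl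
≡ᵇ-comm zero    (suc n) = refl
≡ᵇ-comm (suc m) zero    = refl
≡ᵇ-comm (suc m) (suc n) = ≡ᵇ-comm m n

≢⇒T-not-≡ᵇ : ∀ {m n} → m ≢ n → T (not (m ≡ᵇ n))
≢⇒T-not-≡ᵇ {m} {n} m≢n with m ≡ᵇ n in eq
... | true  = m≢n (≡ᵇ⇒≡ m n (subst T (sym eq) tt))
... | false = tt

adj-sym : ∀ r q n .{{_ : NonZero n}} a b → adj r q n a b ≡ adj r q n b a
adj-sym r q n a b = cong₂ (λ u v → not u ∧ v) (≡ᵇ-comm a b)
  (cong or (map-cong (λ i → ∧-comm (inClique r n i a) (inClique r n i b)) (upTo q)))

module CyclicCliques (d q : ℕ) .{{_ : NonZero d}} .{{_ : NonZero (q * d)}} (2≤d : 2 ≤ d) where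

  r n : ℕ
  r = 2 + d
  n = q * d

  instance
    q≢0 : NonZero q
    q≢0 = m*n≢0⇒m≢0 q

  open InducedEdges (adj r q n) (adj-sym r q n) public

  block : ℕ → ℕ
  block x = x / d

  next prev : ℕ → ℕ
  next k = suc k % q
  prev zero    = pred q
  prev (suc i) = i

  -- the first two vertices of block c, shared by cliques c - 1 and c
  Head : ℕ → ℕ → Set
  Head c x = block x ≡ c × x % d < 2

  prev-next : ∀ {k} → k < q → prev (next k) ≡ k
  prev-next {k} k<q with m≤n⇒m<n∨m≡n k<q
  ... | inj₁ 1+k<q = cong prev (m<n⇒m%n≡m 1+k<q)
  ... | inj₂ 1+k≡q = trans (cong prev (trans (cong (_% q) 1+k≡q) (n%n≡0 q))) (cong pred (sym 1+k≡q))

  block<q : ∀ {x} → x < n → block x < q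
  block<q = m<n*o⇒m/o<n

  coordinates : ∀ c {t x} → t < d → x ≡ (c * d + t) % n → block x ≡ c % q × x % d ≡ t
  coordinates c {t} t<d refl rewrite [m*n+o]%[p*n]≡[m*n]%[p*n]+o c q t<d | sym (m%n*o≡m*o%[n*o] c q d) =
    [m*d+t]/d≡m d (c % q) t<d , [m*d+t]%d≡t d (c % q) t<d

  inClique⁻ : ∀ {k x} → T (inClique r n k x) → ∃ λ j → j < r × x ≡ (k * d + j) % n
  inClique⁻ {k} {x} x∈k with j , j<r , x≡ᵇ ← applyUpTo⁻ id (any⁻ _ (upTo r) x∈k) =
    j , j<r , ≡ᵇ⇒≡ x _ x≡ᵇ

  inClique⇒block⊎Head : ∀ {k x} → k < q → T (inClique r n k x) → block x ≡ k ⊎ Head (next k) x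
  inClique⇒block⊎Head {k} {x} k<q x∈k with inClique⁻ {k} x∈k
  ... | j , j<r , x≡ with j <? d
  ...   | yes j<d = inj₁ (trans (proj₁ (coordinates k j<d x≡)) (m<n⇒m%n≡m k<q))
  ...   | no  j≮d = inj₂ (proj₁ coords , subst (_< 2) (sym (proj₂ coords)) t<2)
    where
    t = j ∸ d
    j≡d+t : j ≡ d + t
    j≡d+t = sym (m+[n∸m]≡n (≮⇒≥ j≮d))
    t<2 : t < 2
    t<2 = m<n+o⇒m∸n<o j d (subst (j <_) (+-comm 2 d) j<r)
    shift : k * d + j ≡ suc k * d + t
    shift = trans (cong (k * d +_) j≡d+t) (trans (sym (+-assoc (k * d) d t)) (cong (_+ t) (+-comm (k * d) d)))
    coords = coordinates (suc k) (<-≤-trans t<2 2≤d) (trans x≡ (cong (_% n) shift))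

  adj⇒Head : ∀ {x y} → T (adj r q n x y) → block y ≢ block x → block y ≢ prev (block x) →
             Head (next (block x)) y
  adj⇒Head {x} {y} x~y y≢ y≢prev with applyUpTo⁻ id (any⁻ _ (upTo q) (proj₂ (Equivalence.to T-∧ x~y)))
  ... | k , k<q , k∋x∧y with Equivalence.to T-∧ k∋x∧y
  ... | k∋x , k∋y with inClique⇒block⊎Head k<q k∋x | inClique⇒block⊎Head k<q k∋y
  ... | inj₁ x∈k       | inj₁ y∈k       = contradiction (trans y∈k (sym x∈k)) y≢
  ... | inj₁ x∈k       | inj₂ y∈head    = subst (λ c → Head (next c) y) (sym x∈k) y∈head
  ... | inj₂ (x∈k' , _) | inj₁ y∈k       =
        contradiction (trans y∈k (sym (trans (cong prev x∈k') (prev-next k<q)))) y≢prev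
  ... | inj₂ (x∈k' , _) | inj₂ (y∈k' , _) = contradiction (trans y∈k' (sym x∈k')) y≢

  adj-in-clique : ∀ k {i j} → k < q → i < j → j < r → k * d + j < n →
                  T (adj r q n (k * d + i) (k * d + j))
  adj-in-clique k {i} {j} k<q i<j j<r kd+j<n = Equivalence.from T-∧
    ( ≢⇒T-not-≡ᵇ (<⇒≢ (+-monoʳ-< (k * d) i<j))
    , any⁺ (λ k′ → inClique r n k′ (k * d + i) ∧ inClique r n k′ (k * d + j))
           (applyUpTo⁺ id (Equivalence.from T-∧ (member (<-trans i<j j<r) kd+i<n , member j<r kd+j<n)) k<q))
    where
    member : ∀ {j} → j < r → k * d + j < n → T (inClique r n k (k * d + j))
    member {j} j<r lt =
      any⁺ (λ j′ → k * d + j ≡ᵇ (k * d + j′) % n) (applyUpTo⁺ id (≡⇒≡ᵇ _ _ (sym (m<n⇒m%n≡m lt))) j<r)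
    kd+i<n : k * d + i < n
    kd+i<n = <-trans (+-monoʳ-< (k * d) i<j) kd+j<n

  heads-length≤2 : ∀ {c ys} → Unique ys → All (Head c) ys → length ys ≤ 2
  heads-length≤2 {c} u heads =
    Unique⇒length≤width (c * d) 2 u (All.map (λ (b≡c , x%d<2) → /≡⇒bounds d _ b≡c x%d<2) heads)

  block-length≤d : ∀ {c ys} → Unique ys → All (λ y → block y ≡ c) ys → length ys ≤ d
  block-length≤d {c} u inBlock =
    Unique⇒length≤width (c * d) d u (All.map (λ {y} b≡c → /≡⇒bounds d y b≡c (m%n<n y d)) inBlock)

  degree-outside-blocks : ∀ {x ys} → Unique ys →
                          All (λ y → block y ≢ block x × block y ≢ prev (block x)) ys →
                          countTrue (adj r q n x) ys ≤ 2
  degree-outside-blocks {x} {ys} u outside = begin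
    countTrue (adj r q n x) ys                         ≡⟨ countTrue≡length-filter (adj r q n x) ys ⟩
    length (filter (T? ∘ adj r q n x) ys)              ≤⟨ heads-length≤2 (Unique.filter⁺ _ u) heads ⟩
    2                                                  ∎
    where
    open ≤-Reasoning
    heads : All (Head (next (block x))) (filter (T? ∘ adj r q n x) ys)
    heads = All.tabulate λ y∈ → let y∈ys , x~y = ∈-filter⁻ (T? ∘ adj r q n x) y∈
                                    y≢ , y≢prev = All.lookup outside y∈ys
                                in adj⇒Head x~y y≢ y≢prev

  -- If every present block had a present predecessor, walking down from a present block would
  -- reach all q blocks, although there are at most |V| < q of them.
  block-after-gap : ∀ {V x} → x ∈ V → All (_< n) V → length V < q →
        ∃ λ z → z ∈ V × All (λ y → block y ≢ prev (block z)) V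
  block-after-gap {V} {x} x∈V V<n |V|<q
    with anyUpTo? (λ i → (i ∈? map block V) ×-dec ¬? (prev i ∈? map block V)) q
  ... | yes (i , _ , i∈B , prev∉B) with z , z∈V , refl ← ∈-map⁻ block i∈B =
        z , z∈V , All.tabulate (λ y∈V y≡ → prev∉B (subst (_∈ map block V) y≡ (∈-map⁺ block y∈V)))
  ... | no  no-gap = contradiction (begin
      q               ≡⟨ length-upTo q ⟨
      length (upTo q) ≤⟨ Unique-⊆⇒length≤ (Unique.upTo⁺ q) all-present ⟩
      length B        ≡⟨ length-map block V ⟩
      length V        ∎) (<⇒≱ |V|<q)
    where
    open ≤-Reasoning
    B = map block V
    <q : ∀ {i} → i ∈ B → i < q
    <q i∈B with y , y∈V , refl ← ∈-map⁻ block i∈B = block<q (All.lookup V<n y∈V)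
    present-pred : ∀ i → suc i ∈ B → i ∈ B
    present-pred i 1+i∈B with i ∈? B
    ... | yes i∈B = i∈B
    ... | no  i∉B = contradiction (suc i , <q 1+i∈B , 1+i∈B , i∉B) no-gap
    0∈B : 0 ∈ B
    0∈B = downward-closed present-pred z≤n (∈-map⁺ block x∈V)
    last∈B : pred q ∈ B
    last∈B with pred q ∈? B
    ... | yes last∈B = last∈B
    ... | no  last∉B = contradiction (0 , <q 0∈B , 0∈B , last∉B) no-gap
    all-present : upTo q ⊆ B
    all-present i∈upTo = downward-closed present-pred (<⇒≤pred (∈-upTo⁻ i∈upTo)) last∈B

  inducedEdges≡edges : ∀ xs → inducedEdges r q n xs ≡ edges xs
  inducedEdges≡edges []       = refl
  inducedEdges≡edges (x ∷ xs) = cong (countTrue (adj r q n x) xs +_) (inducedEdges≡edges xs)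

  edges≤segmentBound : ∀ V → Unique V → All (_< n) V → length V < q →
                       edges V ≤ segmentBound d (length V)
  edges≤segmentBound V = go V (<-wellFounded (length V))
    where
    go : ∀ V → Acc _<_ (length V) → Unique V → All (_< n) V → length V < q →
         edges V ≤ segmentBound d (length V)
    go []         _             _  _   _     = z≤n
    go V@(x ∷ _) (acc smaller) uV V<n |V|<q
      with z , z∈V , noPrev ← block-after-gap (here refl) V<n |V|<q = begin
      edges V                                             ≡⟨ edges-filter-∁ inBlock? V ⟩
      edges W + edges V′ + cross W V′                     ≤⟨ +-mono-≤ (+-mono-≤ (edges≤∑ W) ih) cross-bound ⟩
      ∑[ t < w ] t + segmentBound d v′ + w * (2 ⊓ v′)     ≡⟨ xy∙z≈y∙xz (∑[ t < w ] t) (segmentBound d v′) _ ⟩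
      segmentBound d v′ + (∑[ t < w ] t + w * (2 ⊓ v′))   ≤⟨ segmentBound-+ d v′ w w≤d ⟩
      segmentBound d (v′ + w)                             ≡⟨ cong (segmentBound d) v′+w≡v ⟩
      segmentBound d (length V)                           ∎
      where
      open ≤-Reasoning
      inBlock? : Decidable (λ y → block y ≡ block z)
      inBlock? y = block y ≟ℕ block z
      W  = filter inBlock? V
      V′ = filter (¬? ∘ inBlock?) V
      w  = length W
      v′ = length V′
      v′+w≡v : v′ + w ≡ length V
      v′+w≡v = trans (+-comm v′ w) (length-filter-∁ inBlock? V)
      v′<v : v′ < length V
      v′<v = subst (v′ <_) v′+w≡v (m<m+n v′ (filter-some inBlock? (Any.map (cong block ∘ sym) z∈V)))
      uV′ : Unique V′
      uV′ = Unique.filter⁺ (¬? ∘ inBlock?) uV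
      ih : edges V′ ≤ segmentBound d v′
      ih = go V′ (smaller v′<v) uV′ (All.filter⁺ (¬? ∘ inBlock?) V<n) (<-trans v′<v |V|<q)
      w≤d : w ≤ d
      w≤d = block-length≤d (Unique.filter⁺ inBlock? uV) (all-filter inBlock? V)
      outside : ∀ {x} → x ∈ W → All (λ y → block y ≢ block x × block y ≢ prev (block x)) V′
      outside x∈W with _ , x∈z ← ∈-filter⁻ inBlock? x∈W = All.tabulate λ y∈V′ →
        let y∈V , y∉z = ∈-filter⁻ (¬? ∘ inBlock?) y∈V′ in
        (λ y∈x → y∉z (trans y∈x x∈z)) ,
        (λ y∈prev → All.lookup noPrev y∈V (trans y∈prev (cong prev x∈z)))
      cross-bound : cross W V′ ≤ w * (2 ⊓ v′)
      cross-bound = cross≤ W V′ (All.tabulate λ x∈W →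
        ⊓-glb (degree-outside-blocks uV′ (outside x∈W)) (countTrue≤length _ V′))

  backDegree≤ : ∀ p → p < n → backDegree d p ≤ countTrue (λ x → adj r q n x p) (upTo p)
  backDegree≤ p p<n = subst (λ u → b ≤ countTrue (λ x → adj r q n x u) (upTo u)) (sym p≡lo+b)
    (countTrue-upTo-≥ _ lo b (λ i i<b → adj-in-clique t t<q i<b b<r (subst (_< n) p≡lo+b p<n)))
    where
    b = backDegree d p
    t = block (p ∸ 2)
    lo = t * d
    p≡lo+b : p ≡ lo + b
    p≡lo+b = begin-equality
      p                                 ≡⟨ m⊓n+n∸m≡n 2 p ⟨
      2 ⊓ p + (p ∸ 2)                   ≡⟨ cong (2 ⊓ p +_) (m≡m%n+[m/n]*n (p ∸ 2) d) ⟩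
      2 ⊓ p + ((p ∸ 2) % d + t * d)     ≡⟨ x∙yz≈z∙xy (2 ⊓ p) ((p ∸ 2) % d) (t * d) ⟩
      lo + b                            ∎
      where open ≤-Reasoning
    t<q : t < q
    t<q = block<q (≤-<-trans (m∸n≤m p 2) p<n)
    b<r : b < r
    b<r = +-mono-≤-< (m⊓n≤m 2 p) (m%n<n (p ∸ 2) d)

  segmentBound≤edges : ∀ v → v ≤ n → segmentBound d v ≤ edges (upTo v)
  segmentBound≤edges zero    _     = z≤n
  segmentBound≤edges (suc v) 1+v≤n = begin
    segmentBound d v + backDegree d v
      ≤⟨ +-mono-≤ (segmentBound≤edges v (<⇒≤ 1+v≤n)) (backDegree≤ v 1+v≤n) ⟩
    edges (upTo v) + countTrue (λ x → adj r q n x v) (upTo v)     ≡⟨ edges-∷ʳ (upTo v) v ⟨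
    edges (upTo v ++ [ v ])                                        ≡⟨ cong edges (upTo-∷ʳ v) ⟩
    edges (upTo (suc v))                                           ∎
    where open ≤-Reasoning

  segment-from-0 : ∀ v → v ≤ n → segment n 0 v ≡ upTo v
  segment-from-0 v v≤n =
    map-id-local (All.tabulate (λ j∈ → m<n⇒m%n≡m (<-≤-trans (∈-upTo⁻ j∈) v≤n)))

lemma3p10 : (r q n : ℕ) → .{{_ : NonZero n}} → 4 ≤ r → n ≡ q * (r ∸ 2)
          → (V : List ℕ) → Unique V → All (_< n) V
          → r ≤ length V → 2 * r * (length V ∸ 1) ≤ n
          → Σ ℕ (λ s → s < n × inducedEdges r q n V ≤ inducedEdges r q n (segment n s (length V)))
lemma3p10 r@(suc (suc (suc (suc e)))) q n (s≤s (s≤s (s≤s (s≤s _)))) refl V uV V<n r≤v bound =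
  0 , >-nonZero⁻¹ n , (begin
    inducedEdges r q n V                           ≡⟨ inducedEdges≡edges V ⟩
    edges V                                        ≤⟨ edges≤segmentBound V uV V<n v<q ⟩
    segmentBound d v                               ≤⟨ segmentBound≤edges v v≤n ⟩
    edges (upTo v)                                 ≡⟨ inducedEdges≡edges (upTo v) ⟨
    inducedEdges r q n (upTo v)                    ≡⟨ cong (inducedEdges r q n) (segment-from-0 v v≤n) ⟨
    inducedEdges r q n (segment n 0 v)             ∎)
  where
  open ≤-Reasoning
  d = suc (suc e)
  v = length V
  open CyclicCliques d q (s≤s (s≤s z≤n)) hiding (r; n)
  v<q : v < q
  v<q = few-vertices d q v (≤-trans (s≤s (s≤s z≤n)) r≤v) bound
  v≤n : v ≤ n
  v≤n = ≤-trans (<⇒≤ v<q) (m≤m*n q d)
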